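{- Let $G$ be a graph (without loops or multiple edges) with no isolated vertices, and suppose there exists no nontrivial circuit injection $f: G_M\to B$ with $B$ a binary matroid. Then for every subgraph (set of edges) $S$ of $G$, if $v_1,\ldots,v_n$ are vertices of odd degree in $S$, there exists a circuit $C$ of $G$ such that $v_1,\ldots,v_n$ are all vertices of $C$.
   Context: $G_M$ denotes the cycle matroid of $G$: its cells are the edges of $G$ and its circuits are the circuits (cycles, as edge sets) of $G$. A matroid $\{S,\mathscr{C}\}$ is given by its cell set and circuit family. It is binary if for all $A,B\in\mathscr{C}$, $A\oplus B=(A\cup B)\setminus(A\cap B)$ is a union of pairwise disjoint circuits. A circuit injection $f:\{S,\mathscr{C}\}\to\{S',\mathscr{C}'\}$ is a bijection $S\to S'$ mapping every member of $\mathscr{C}$ to a member of $\mathscr{C}'$; it is nontrivial if some member of $\mathscr{C}'$ is not the image of a member of $\mathscr{C}$. -}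

module Defs where

open import Data.Nat using (ℕ; suc; _%_)
open import Data.Nat.DivMod using (m%n<n)
open import Data.Fin using (Fin; toℕ; fromℕ<; _≟_)
open import Data.Fin.Subset using (Subset; _∈_; _∉_; _⊆_; _∪_; _∩_; _─_; ⋃; ∣_∣)
open import Data.Vec using (tabulate)
open import Data.Bool using (_∨_)
open import Data.List using (List)
open import Data.List.Relation.Unary.All using (All)
open import Data.List.Relation.Unary.AllPairs using (AllPairs)
open import Data.Product using (Σ; ∃; _×_; _,_; proj₁; proj₂)
open import Data.Sum using (_⊎_)
open import Data.Empty using (⊥)
open import Relation.Nullary using (¬_)
open import Relation.Nullary.Decidable using (⌊_⌋)
open import Relation.Binary.PropositionalEquality using (_≡_; _≢_)
open import Function.Definitions using (Injective; Bijective)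
open import Function.Bundles using (_⇔_)

-- Finite simple graphs: vertices Fin V, edges Fin E, each edge has two
-- (ordered representation of its unordered pair of) endpoints.

record Graph : Set where
  field
    V E      : ℕ
    ends     : Fin E → Fin V × Fin V
    loopless : ∀ e → proj₁ (ends e) ≢ proj₂ (ends e)
    simple   : ∀ e e′ → (ends e ≡ ends e′ ⊎ ends e ≡ (proj₂ (ends e′) , proj₁ (ends e′)))
                      → e ≡ e′

module _ (G : Graph) where
  open Graph G

  Joins : Fin E → Fin V → Fin V → Set
  Joins e a b = ends e ≡ (a , b) ⊎ ends e ≡ (b , a)

  IncidentTo : Fin V → Fin E → Set
  IncidentTo v e = proj₁ (ends e) ≡ v ⊎ proj₂ (ends e) ≡ v

  NoIsolatedVertices : Set
  NoIsolatedVertices = ∀ v → ∃ λ e → IncidentTo v e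

  incident : Fin V → Subset E
  incident v = tabulate λ e → ⌊ proj₁ (ends e) ≟ v ⌋ ∨ ⌊ proj₂ (ends e) ≟ v ⌋

  degIn : Subset E → Fin V → ℕ
  degIn S v = ∣ S ∩ incident v ∣

  OddDegIn : Subset E → Fin V → Set
  OddDegIn S v = degIn S v % 2 ≡ 1

  next : ∀ {k} → Fin (suc k) → Fin (suc k)
  next {k} i = fromℕ< (m%n<n (suc (toℕ i)) (suc k))

  -- C is (the edge set of) a circuit/cycle of G: there are k ≥ 3 distinct
  -- vertices w₀ … w_{k-1}, consecutive ones (cyclically) adjacent, and C is
  -- exactly the set of edges joining consecutive ones.
  IsCircuit : Subset E → Set
  IsCircuit C =
    Σ ℕ λ k → Σ (Fin (suc (suc (suc k))) → Fin V) λ w →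
      Injective _≡_ _≡_ w ×
      (∀ i → ∃ λ e → Joins e (w i) (w (next i))) ×
      (∀ e → (e ∈ C ⇔ (∃ λ i → Joins e (w i) (w (next i)))))

  VertexOf : Fin V → Subset E → Set
  VertexOf v C = ∃ λ e → e ∈ C × IncidentTo v e

record Matroid : Set₁ where
  field
    m       : ℕ
    Circuit : Subset m → Set
    nonempty : ∀ C → Circuit C → ∃ λ x → x ∈ C
    incomparable : ∀ A B → Circuit A → Circuit B → A ⊆ B → A ≡ B
    elimination : ∀ A B → Circuit A → Circuit B → A ≢ B → ∀ x → x ∈ A → x ∈ B →
                  ∃ λ D → Circuit D × D ⊆ (A ∪ B) × x ∉ D

Disjoint : ∀ {n} → Subset n → Subset n → Set
Disjoint X Y = ∀ x → x ∈ X → x ∈ Y → ⊥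

_⊕_ : ∀ {n} → Subset n → Subset n → Subset n
A ⊕ B = (A ∪ B) ─ (A ∩ B)

UnionOfDisjointCircuits : (M : Matroid) → Subset (Matroid.m M) → Set
UnionOfDisjointCircuits M X =
  ∃ λ (Ds : List (Subset (Matroid.m M))) →
    All (Matroid.Circuit M) Ds × AllPairs Disjoint Ds × ⋃ Ds ≡ X

IsBinary : Matroid → Set
IsBinary M = ∀ A B → Circuit A → Circuit B → UnionOfDisjointCircuits M (A ⊕ B)
  where open Matroid M

module _ (G : Graph) (B : Matroid) where
  open Graph G
  open Matroid B renaming (Circuit to CircuitB)

  MapsTo : (Fin E → Fin m) → Subset E → Subset m → Set
  MapsTo f X Y = ∀ e → (e ∈ X ⇔ f e ∈ Y)

  IsCircuitInjection : (Fin E → Fin m) → Set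
  IsCircuitInjection f =
    Bijective _≡_ _≡_ f ×
    (∀ X → IsCircuit G X → ∃ λ Y → CircuitB Y × MapsTo f X Y)

  IsNontrivial : (Fin E → Fin m) → Set
  IsNontrivial f = ∃ λ Y → CircuitB Y × ¬ (∃ λ X → IsCircuit G X × MapsTo f X Y)

NoNontrivialBinaryCircuitInjection : Graph → Set₁
NoNontrivialBinaryCircuitInjection G =
  ¬ (Σ Matroid λ B → IsBinary B ×
       Σ (Fin (Graph.E G) → Fin (Matroid.m B)) λ f →
         IsCircuitInjection G B f × IsNontrivial G B f)

module Submission where

-- Suppose no circuit of G passes through
-- all of v₀, …, vₙ.  Call an edge set Y *even* if it has even degree at every
-- vertex, and *like S* if it has the degree parities of S.  The family W of
-- edge sets that are even or like S is closed under symmetric difference, and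
-- the minimal nonempty members of any such family are the circuits of a binary
-- matroid B on the edges.  Every circuit X of G is a circuit of B: it is even;
-- an even nonempty subset of a cycle is the whole cycle; and a member of W
-- inside X that is like S meets every vᵢ (each vᵢ has odd degree in S), which
-- would make X a circuit through all of them.  So the identity G_M → B is a
-- circuit injection.  It is nontrivial: a minimal member of W inside S that is
-- odd at some vertex is a circuit of B but not of G, since circuits of G are
-- even.  This contradicts the hypothesis.  To obtain the circuit itself
-- constructively, we first decide its existence by a finite search.

open import Defs
open import Data.Nat as ℕ using (ℕ; zero; suc; _<_; _%_; s≤s)
import Data.Nat.Properties as ℕ
open import Data.Nat.DivMod using (m<n⇒m%n≡m; n%n≡0)
open import Data.Bool using (Bool; true; false; not; _∧_; _∨_; _xor_)
open import Data.Bool.Properties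
  using (xor-∧-commutativeRing; ∧-distribʳ-xor; ∧-identityʳ; ¬-not; xor-identityʳ; xor-comm; xor-same; T-≡; T-∨)
  renaming (_≟_ to _≟ᵇ_)
open import Data.Vec using ([]; _∷_; lookup; tabulate; here; there)
open import Data.Vec.Properties
  using ([]=⇒lookup; lookup⇒[]=; lookup-zipWith; lookup∘tabulate; tabulate∘lookup; tabulate-cong)
open import Data.Vec.Functional as Vector using (head; tail)
open import Data.Fin using (Fin; zero; suc; toℕ; fromℕ; inject₁; _≟_)
open import Data.Fin.Properties
  using (any?; all?; suc-injective; toℕ-injective; toℕ-fromℕ<; toℕ-fromℕ; toℕ-inject₁; toℕ<n; injective⇒≤)
open import Data.Fin.Induction using (<-weakInduction)
open import Data.Fin.Subset using (Subset; ⋃; _∈_; _∉_; _⊆_; _⊂_; _∪_; _∩_; Nonempty; Empty; ∣_∣; ⊥)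
open import Data.Fin.Subset.Properties
  using (_∈?_; _⊆?_; _⊂?_; nonempty?; anySubset?; ⊆-trans; ⊆-antisym; p⊂q⇒∣p∣<∣q∣; Empty-unique;
         p⊆p∪q; q⊆p∪q; x∈p∪q⁺; x∈p∪q⁻; x∈p∩q⁻)
open import Data.Product as Product using (∃; _×_; _,_; proj₁; proj₂)
open import Data.Product.Properties using (≡-dec)
open import Data.Sum as Sum using (_⊎_; inj₁; inj₂; [_,_]; swap)
open import Data.Unit using (⊤; tt)
open import Data.List using (List; []; _∷_)
open import Data.List.Relation.Unary.All as All using (All; []; _∷_)
open import Data.List.Relation.Unary.AllPairs using ([]; _∷_)
open import Function using (id; _∘_; case_of_)
open import Function.Bundles using (_⇔_; Equivalence; mk⇔)
open import Function.Definitions using (Injective)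
open import Function.Construct.Identity using (bijective)
open import Relation.Nullary using (¬_; Dec; yes; no; ¬?; contradiction)
open import Relation.Nullary.Decidable
  using (⌊_⌋; map′; _×-dec_; _⊎-dec_; _→-dec_; decidable-stable; toWitness; fromWitness)
open import Relation.Binary.PropositionalEquality
  using (_≡_; _≢_; refl; sym; trans; cong; cong₂; subst; subst₂; module ≡-Reasoning)
open import Algebra.Bundles using (CommutativeRing)
open import Algebra.Properties.CommutativeSemigroup
  (CommutativeRing.+-commutativeSemigroup xor-∧-commutativeRing) using (interchange)

private
  variable
    n : ℕ
    p q : Subset n
    x : Fin n

∈⇒lookup : x ∈ p → lookup p x ≡ true
∈⇒lookup = []=⇒lookup

lookup⇒∈ : lookup p x ≡ true → x ∈ p
lookup⇒∈ {p = p} {x = x} = lookup⇒[]= x p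

∉⇒lookup : x ∉ p → lookup p x ≡ false
∉⇒lookup x∉p = ¬-not (x∉p ∘ lookup⇒∈)

subset-ext : (∀ x → lookup p x ≡ lookup q x) → p ≡ q
subset-ext {p = p} {q = q} same =
  trans (sym (tabulate∘lookup p)) (trans (tabulate-cong same) (tabulate∘lookup q))

⊕-∷ : ∀ a b (p q : Subset n) → (a ∷ p) ⊕ (b ∷ q) ≡ (a xor b) ∷ (p ⊕ q)
⊕-∷ true  true  p q = refl
⊕-∷ true  false p q = refl
⊕-∷ false true  p q = refl
⊕-∷ false false p q = refl

lookup-⊕ : ∀ (p q : Subset n) x → lookup (p ⊕ q) x ≡ lookup p x xor lookup q x
lookup-⊕ (a ∷ p) (b ∷ q) zero    = cong (λ r → lookup r zero) (⊕-∷ a b p q)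
lookup-⊕ (a ∷ p) (b ∷ q) (suc x) = trans (cong (λ r → lookup r (suc x)) (⊕-∷ a b p q)) (lookup-⊕ p q x)

xor≡true : ∀ a b → a xor b ≡ true → a ≡ true ⊎ b ≡ true
xor≡true true  b _ = inj₁ refl
xor≡true false b h = inj₂ h
xor≡false⇒≡ : ∀ a b → a xor b ≡ false → a ≡ b
xor≡false⇒≡ true  true  _ = refl
xor≡false⇒≡ false false _ = refl

∈⊕⁻ : x ∈ p ⊕ q → x ∈ p ⊎ x ∈ q
∈⊕⁻ {x = x} {p = p} {q = q} x∈p⊕q =
  Sum.map lookup⇒∈ lookup⇒∈ (xor≡true _ _ (trans (sym (lookup-⊕ p q x)) (∈⇒lookup x∈p⊕q)))

∈⊕ˡ : x ∈ p → x ∉ q → x ∈ p ⊕ q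
∈⊕ˡ {x = x} {p = p} {q = q} x∈p x∉q =
  lookup⇒∈ (trans (lookup-⊕ p q x) (cong₂ _xor_ (∈⇒lookup x∈p) (∉⇒lookup x∉q)))

∈⊕ʳ : x ∉ p → x ∈ q → x ∈ p ⊕ q
∈⊕ʳ {x = x} {p = p} {q = q} x∉p x∈q =
  lookup⇒∈ (trans (lookup-⊕ p q x) (cong₂ _xor_ (∉⇒lookup x∉p) (∈⇒lookup x∈q)))

∉⊕ : x ∈ p → x ∈ q → x ∉ p ⊕ q
∉⊕ {x = x} {p = p} {q = q} x∈p x∈q x∈p⊕q = case true≡false of λ ()
  where
  true≡false : true ≡ false
  true≡false = trans (sym (∈⇒lookup x∈p⊕q))
                 (trans (lookup-⊕ p q x) (cong₂ _xor_ (∈⇒lookup x∈p) (∈⇒lookup x∈q)))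

⊕⊆∪ : p ⊕ q ⊆ p ∪ q
⊕⊆∪ {p = p} {q = q} = x∈p∪q⁺ ∘ ∈⊕⁻

⊕-⊆ : q ⊆ p → p ⊕ q ⊆ p
⊕-⊆ q⊆p = [ id , q⊆p ] ∘ ∈⊕⁻

⊕-⊂ : q ⊆ p → Nonempty q → p ⊕ q ⊂ p
⊕-⊂ q⊆p (x , x∈q) = ⊕-⊆ q⊆p , x , q⊆p x∈q , ∉⊕ (q⊆p x∈q) x∈q

⊂⇒⊕-nonempty : q ⊂ p → Nonempty (p ⊕ q)
⊂⇒⊕-nonempty (_ , x , x∈p , x∉q) = x , ∈⊕ˡ x∈p x∉q

⊈⇒witness : ¬ (p ⊆ q) → ∃ λ x → x ∈ p × x ∉ q
⊈⇒witness {p = p} {q = q} p⊈q with any? (λ x → x ∈? p ×-dec ¬? (x ∈? q))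
... | yes found = found
... | no none = contradiction
  (λ {x} x∈p → decidable-stable (x ∈? q) (λ x∉q → none (x , x∈p , x∉q))) p⊈q

⊆∧⊈⇒⊂ : q ⊆ p → ¬ (p ⊆ q) → q ⊂ p
⊆∧⊈⇒⊂ q⊆p p⊈q = q⊆p , ⊈⇒witness p⊈q

∪-⊕-cancel : q ⊆ p → q ∪ (p ⊕ q) ≡ p
∪-⊕-cancel {q = q} {p = p} q⊆p = ⊆-antisym
  ([ q⊆p , ⊕-⊆ q⊆p ] ∘ x∈p∪q⁻ q (p ⊕ q))
  (λ {x} x∈p → x∈p∪q⁺ (case x ∈? q of λ where
    (yes x∈q) → inj₁ x∈q
    (no x∉q)  → inj₂ (∈⊕ˡ x∈p x∉q)))

⊕-empty⇒≡ : Empty (p ⊕ q) → p ≡ q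
⊕-empty⇒≡ {p = p} {q = q} empty = ⊆-antisym
  (λ {x} x∈p → decidable-stable (x ∈? q) (λ x∉q → empty (x , ∈⊕ˡ x∈p x∉q)))
  (λ {x} x∈q → decidable-stable (x ∈? p) (λ x∉p → empty (x , ∈⊕ʳ x∉p x∈q)))

parity : Subset n → Bool
parity []      = false
parity (b ∷ p) = b xor parity p

parity-⊕ : ∀ (p q : Subset n) → parity (p ⊕ q) ≡ parity p xor parity q
parity-⊕ []      []      = refl
parity-⊕ (a ∷ p) (b ∷ q) = begin
  parity ((a ∷ p) ⊕ (b ∷ q))            ≡⟨ cong parity (⊕-∷ a b p q) ⟩
  (a xor b) xor parity (p ⊕ q)          ≡⟨ cong ((a xor b) xor_) (parity-⊕ p q) ⟩
  (a xor b) xor (parity p xor parity q) ≡⟨ interchange a b (parity p) (parity q) ⟩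
  (a xor parity p) xor (b xor parity q) ∎
  where open ≡-Reasoning

∩-distribʳ-⊕ : ∀ (p q r : Subset n) → (p ⊕ q) ∩ r ≡ (p ∩ r) ⊕ (q ∩ r)
∩-distribʳ-⊕ p q r = subset-ext λ x → begin
  lookup ((p ⊕ q) ∩ r) x                         ≡⟨ lookup-zipWith _∧_ x (p ⊕ q) r ⟩
  lookup (p ⊕ q) x ∧ lookup r x                  ≡⟨ cong (_∧ lookup r x) (lookup-⊕ p q x) ⟩
  (lookup p x xor lookup q x) ∧ lookup r x       ≡⟨ ∧-distribʳ-xor (lookup r x) (lookup p x) (lookup q x) ⟩
  (lookup p x ∧ lookup r x) xor (lookup q x ∧ lookup r x)
    ≡⟨ sym (cong₂ _xor_ (lookup-zipWith _∧_ x p r) (lookup-zipWith _∧_ x q r)) ⟩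
  lookup (p ∩ r) x xor lookup (q ∩ r) x          ≡⟨ sym (lookup-⊕ (p ∩ r) (q ∩ r) x) ⟩
  lookup ((p ∩ r) ⊕ (q ∩ r)) x                   ∎
  where open ≡-Reasoning

parity-true⇒nonempty : parity p ≡ true → Nonempty p
parity-true⇒nonempty {p = true  ∷ p} _   = zero , here
parity-true⇒nonempty {p = false ∷ p} odd = Product.map suc there (parity-true⇒nonempty odd)

parity-empty : ∀ {n} {p : Subset n} → Empty p → parity p ≡ false
parity-empty {n = n} empty = trans (cong parity (Empty-unique empty)) (parity-⊥ n)
  where
  parity-⊥ : ∀ n → parity (⊥ {n}) ≡ false
  parity-⊥ zero    = refl
  parity-⊥ (suc n) = parity-⊥ n

parity-single : ∀ {a : Fin n} → (∀ {x} → x ∈ p → x ≡ a) → parity p ≡ lookup p a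
parity-single {p = b ∷ p} {a = zero} only-a =
  trans (cong (b xor_) (parity-empty λ (x , x∈p) → case only-a (there x∈p) of λ ())) (xor-identityʳ b)
parity-single {p = true  ∷ p} {a = suc a} only-a = case only-a here of λ ()
parity-single {p = false ∷ p} {a = suc a} only-a = parity-single (suc-injective ∘ only-a ∘ there)

parity-pair : ∀ {a b : Fin n} → a ≢ b → (∀ {x} → x ∈ p → x ≡ a ⊎ x ≡ b) →
              parity p ≡ lookup p a xor lookup p b
parity-pair {a = zero}  {b = zero}  a≢b _ = contradiction refl a≢b
parity-pair {p = c ∷ p} {a = zero} {b = suc b} _ only-ab =
  cong (c xor_) (parity-single (λ x∈p → case only-ab (there x∈p) of λ where
    (inj₂ eq) → suc-injective eq))
parity-pair {p = c ∷ p} {a = suc a} {b = zero} a≢b only-ab =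
  trans (parity-pair (a≢b ∘ sym) (swap ∘ only-ab)) (xor-comm c (lookup p a))
parity-pair {p = true  ∷ p} {a = suc a} {b = suc b} _ only-ab = case only-ab here of λ where
  (inj₁ ())
  (inj₂ ())
parity-pair {p = false ∷ p} {a = suc a} {b = suc b} a≢b only-ab =
  parity-pair (a≢b ∘ cong suc) (Sum.map suc-injective suc-injective ∘ only-ab ∘ there)

isOdd : ℕ → Bool
isOdd zero    = false
isOdd (suc m) = not (isOdd m)

isOdd-∣∣ : ∀ (p : Subset n) → isOdd ∣ p ∣ ≡ parity p
isOdd-∣∣ []          = refl
isOdd-∣∣ (true  ∷ p) = cong not (isOdd-∣∣ p)
isOdd-∣∣ (false ∷ p) = isOdd-∣∣ p

%2≡1⇒isOdd : ∀ m → m % 2 ≡ 1 → isOdd m ≡ true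
%2≡1⇒isOdd (suc zero)    _   = refl
%2≡1⇒isOdd (suc (suc m)) odd = cong not (cong not (%2≡1⇒isOdd m odd))

⊂-size : ∀ {k} → q ⊂ p → ∣ p ∣ < suc k → ∣ q ∣ < k
⊂-size q⊂p size = ℕ.<-≤-trans (p⊂q⇒∣p∣<∣q∣ q⊂p) (ℕ.s≤s⁻¹ size)

⊆⋃ : ∀ (Ps : List (Subset n)) → All (_⊆ ⋃ Ps) Ps
⊆⋃ []       = []
⊆⋃ (P ∷ Ps) =
  p⊆p∪q (⋃ Ps) ∷ All.map (λ P′⊆⋃Ps {x} x∈P′ → q⊆p∪q P (⋃ Ps) (P′⊆⋃Ps x∈P′)) (⊆⋃ Ps)

subsetOf : ∀ {n} {P : Fin n → Set} → (∀ x → Dec (P x)) → Subset n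
subsetOf P? = tabulate (λ x → ⌊ P? x ⌋)

∈subsetOf⇔ : ∀ {n} {P : Fin n → Set} (P? : ∀ x → Dec (P x)) {x} → x ∈ subsetOf P? ⇔ P x
∈subsetOf⇔ P? {x} = mk⇔
  (λ x∈ → toWitness (from T-≡ (trans (sym (lookup∘tabulate _ x)) (∈⇒lookup x∈))))
  (λ Px → lookup⇒∈ (trans (lookup∘tabulate _ x) (to T-≡ (fromWitness Px))))
  where open Equivalence

-- The binary matroid of a family W of subsets of Fin m that is decidable and
-- closed under ⊕: its circuits are the minimal nonempty members of W.
-- Minimal members are found by descent on the size, replacing a member Z by a
-- smaller nonempty member Z′ ⊂ Z or by Z ⊕ Z′ (also a member, also smaller).
module BinaryMatroidOf {m : ℕ} (W : Subset m → Set) (W? : ∀ Y → Dec (W Y))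
                       (W-⊕ : ∀ A B → W A → W B → W (A ⊕ B)) where

  Minimal : Subset m → Set
  Minimal Y = ∀ Z → W Z → Z ⊆ Y → Nonempty Z → Y ⊆ Z

  IsMinimalMember : Subset m → Set
  IsMinimalMember Y = W Y × Nonempty Y × Minimal Y

  no-smaller⇒minimal : ∀ {Y} → ¬ (∃ λ Z → W Z × Nonempty Z × Z ⊂ Y) → Minimal Y
  no-smaller⇒minimal {Y} none Z wZ Z⊆Y neZ with Y ⊆? Z
  ... | yes Y⊆Z = Y⊆Z
  ... | no Y⊈Z  = contradiction (Z , wZ , neZ , ⊆∧⊈⇒⊂ Z⊆Y Y⊈Z) none

  module Descent (R : Subset m → Set) (R-split : ∀ Z Z′ → R Z → R Z′ ⊎ R (Z ⊕ Z′)) where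

    MinimalBelow : Subset m → Set
    MinimalBelow Z = ∃ λ D → IsMinimalMember D × D ⊆ Z × R D

    descend : ∀ k {Z} → ∣ Z ∣ < k → W Z → Nonempty Z → R Z → MinimalBelow Z
    descend (suc k) {Z} size wZ neZ rZ =
      case anySubset? (λ Z′ → W? Z′ ×-dec nonempty? Z′ ×-dec Z′ ⊂? Z) of λ where
        (no none) → Z , (wZ , neZ , no-smaller⇒minimal none) , (λ {_} x∈Z → x∈Z) , rZ
        (yes (Z′ , wZ′ , neZ′ , Z′⊂Z)) → case R-split Z Z′ rZ of λ where
          (inj₁ rZ′) → recurse Z′⊂Z wZ′ neZ′ rZ′
          (inj₂ rZ⊕) →
            recurse (⊕-⊂ (proj₁ Z′⊂Z) neZ′) (W-⊕ Z Z′ wZ wZ′) (⊂⇒⊕-nonempty Z′⊂Z) rZ⊕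
      where
      recurse : ∀ {Z′} → Z′ ⊂ Z → W Z′ → Nonempty Z′ → R Z′ → MinimalBelow Z
      recurse Z′⊂Z wZ′ neZ′ rZ′ =
        let D , minD , D⊆Z′ , rD = descend k (⊂-size Z′⊂Z size) wZ′ neZ′ rZ′
        in D , minD , ⊆-trans D⊆Z′ (proj₁ Z′⊂Z) , rD

    minimal-below : ∀ {Z} → W Z → Nonempty Z → R Z → MinimalBelow Z
    minimal-below {Z} = descend (suc ∣ Z ∣) ℕ.≤-refl

  open Descent (λ _ → ⊤) (λ _ _ _ → inj₁ tt) using (minimal-below)

  incomparable : ∀ A B → IsMinimalMember A → IsMinimalMember B → A ⊆ B → A ≡ B
  incomparable A B (wA , neA , _) (_ , _ , minB) A⊆B = ⊆-antisym A⊆B (minB A wA A⊆B neA)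

  elimination : ∀ A B → IsMinimalMember A → IsMinimalMember B → A ≢ B → ∀ x → x ∈ A → x ∈ B →
                ∃ λ D → IsMinimalMember D × D ⊆ (A ∪ B) × x ∉ D
  elimination A B (wA , _) (wB , _) A≢B x x∈A x∈B with nonempty? (A ⊕ B)
  ... | no empty = contradiction (⊕-empty⇒≡ empty) A≢B
  ... | yes ne =
    let D , minD , D⊆A⊕B , _ = minimal-below (W-⊕ A B wA wB) ne tt
    in D , minD , ⊕⊆∪ ∘ D⊆A⊕B , λ x∈D → ∉⊕ x∈A x∈B (D⊆A⊕B x∈D)

  matroid : Matroid
  matroid = record
    { m            = m
    ; Circuit      = IsMinimalMember
    ; nonempty     = λ _ → proj₁ ∘ proj₂
    ; incomparable = incomparable
    ; elimination  = elimination
    }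

  -- Every member of W is a disjoint union of minimal members: peel off a
  -- minimal D ⊆ Z and decompose the smaller member Z ⊕ D.
  decompose : ∀ k {Z} → ∣ Z ∣ < k → W Z → UnionOfDisjointCircuits matroid Z
  decompose (suc k) {Z} size wZ with nonempty? Z
  ... | no empty = [] , [] , [] , sym (Empty-unique empty)
  ... | yes neZ with minimal-below wZ neZ tt
  ...   | D , minD , D⊆Z , _
        with decompose k (⊂-size (⊕-⊂ D⊆Z (proj₁ (proj₂ minD))) size) (W-⊕ Z D wZ (proj₁ minD))
  ...     | Ds , minDs , disjoint , ⋃Ds≡Z⊕D =
    D ∷ Ds , minD ∷ minDs , All.map D-disjoint (⊆⋃ Ds) ∷ disjoint ,
    trans (cong (D ∪_) ⋃Ds≡Z⊕D) (∪-⊕-cancel D⊆Z)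
    where
    D-disjoint : ∀ {E} → E ⊆ ⋃ Ds → Disjoint D E
    D-disjoint E⊆⋃Ds x x∈D x∈E = ∉⊕ (D⊆Z x∈D) x∈D (subst (x ∈_) ⋃Ds≡Z⊕D (E⊆⋃Ds x∈E))

  binary : IsBinary matroid
  binary A B (wA , _) (wB , _) = decompose _ ℕ.≤-refl (W-⊕ A B wA wB)

-- Properties of the cyclic successor `next` on Fin (suc k), which indexes the
-- vertices of a cycle.
module CyclicSuccessor (G : Graph) where

  sucMod-cases : ∀ {k} t → t < suc k →
                 (suc t < suc k × suc t % suc k ≡ suc t) ⊎ (suc t ≡ suc k × suc t % suc k ≡ 0)
  sucMod-cases {k} t t<n with ℕ.m≤n⇒m<n∨m≡n t<n
  ... | inj₁ 1+t<n = inj₁ (1+t<n , m<n⇒m%n≡m 1+t<n)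
  ... | inj₂ 1+t≡n = inj₂ (1+t≡n , trans (cong (_% suc k) 1+t≡n) (n%n≡0 (suc k)))

  toℕ-next : ∀ {k} (i : Fin (suc k)) → toℕ (next G i) ≡ suc (toℕ i) % suc k
  toℕ-next i = toℕ-fromℕ< _

  next-cases : ∀ {k} (i : Fin (suc k)) →
               (suc (toℕ i) < suc k × toℕ (next G i) ≡ suc (toℕ i)) ⊎
               (suc (toℕ i) ≡ suc k × toℕ (next G i) ≡ 0)
  next-cases i with sucMod-cases (toℕ i) (toℕ<n i)
  ... | inj₁ (lt , eq) = inj₁ (lt , trans (toℕ-next i) eq)
  ... | inj₂ (eq₁ , eq₂) = inj₂ (eq₁ , trans (toℕ-next i) eq₂)

  next-inject₁ : ∀ {k} (j : Fin k) → next G (inject₁ j) ≡ suc j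
  next-inject₁ {k} j = toℕ-injective (begin
    toℕ (next G (inject₁ j))    ≡⟨ toℕ-next (inject₁ j) ⟩
    suc (toℕ (inject₁ j)) % suc k ≡⟨ cong (λ t → suc t % suc k) (toℕ-inject₁ j) ⟩
    suc (toℕ j) % suc k          ≡⟨ m<n⇒m%n≡m (s≤s (toℕ<n j)) ⟩
    suc (toℕ j)                  ∎)
    where open ≡-Reasoning

  next-last : ∀ {k} → next G (fromℕ k) ≡ zero
  next-last {k} = toℕ-injective (trans (toℕ-next (fromℕ k))
    (trans (cong (λ t → suc t % suc k) (toℕ-fromℕ k)) (n%n≡0 (suc k))))

  next-surjective : ∀ {k} (j : Fin (suc k)) → ∃ λ i → next G i ≡ j
  next-surjective zero    = _ , next-last
  next-surjective (suc j) = inject₁ j , next-inject₁ j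

  next-injective : ∀ {k} → Injective _≡_ _≡_ (next G {k})
  next-injective {k} {i} {j} eq with next-cases i | next-cases j | cong toℕ eq
  ... | inj₁ (_ , p) | inj₁ (_ , q) | e = toℕ-injective (ℕ.suc-injective (trans (sym p) (trans e q)))
  ... | inj₁ (_ , p) | inj₂ (_ , q) | e = contradiction (trans (sym p) (trans e q)) λ ()
  ... | inj₂ (_ , p) | inj₁ (_ , q) | e = contradiction (trans (sym q) (trans (sym e) p)) λ ()
  ... | inj₂ (p , _) | inj₂ (q , _) | _ = toℕ-injective (ℕ.suc-injective (trans p (sym q)))

  next-induction : ∀ {k ℓ} (P : Fin (suc k) → Set ℓ) →
                   P zero → (∀ i → P i → P (next G i)) → ∀ i → P i
  next-induction P P₀ step = <-weakInduction P P₀ λ j Pj → subst P (next-inject₁ j) (step _ Pj)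

  next≢ : ∀ {k} (i : Fin (suc (suc k))) → next G i ≢ i
  next≢ i eq with next-cases i | cong toℕ eq
  ... | inj₁ (_ , p) | e = ℕ.1+n≢n (trans (sym p) e)
  ... | inj₂ (p , q) | e = contradiction (trans (cong suc (trans (sym q) e)) p) λ ()

  next²≢ : ∀ {k} (i : Fin (suc (suc (suc k)))) → next G (next G i) ≢ i
  next²≢ i eq with next-cases i | next-cases (next G i) | cong toℕ eq
  ... | inj₁ (_ , p) | inj₁ (_ , q) | e =
    ℕ.>⇒≢ (ℕ.m<n⇒m<1+n (ℕ.n<1+n _)) (trans (sym (trans q (cong suc p))) e)
  ... | inj₁ (_ , p) | inj₂ (q₁ , q₂) | e =
    contradiction (trans (cong suc (sym (trans p (cong suc (trans (sym e) q₂))))) q₁) λ ()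
  ... | inj₂ (p₁ , p₂) | inj₁ (_ , q) | e =
    contradiction (trans (cong suc (trans (sym (trans q (cong suc p₂))) e)) p₁) λ ()
  ... | inj₂ (_ , p₂) | inj₂ (q₁ , _) | _ = contradiction (trans (cong suc (sym p₂)) q₁) λ ()

module GraphFacts (G : Graph) where
  open Graph G

  joins-unique : ∀ {e e′ a b} → Joins G e a b → Joins G e′ a b → e ≡ e′
  joins-unique {e} {e′} (inj₁ p) (inj₁ q) = simple e e′ (inj₁ (trans p (sym q)))
  joins-unique {e} {e′} (inj₂ p) (inj₂ q) = simple e e′ (inj₁ (trans p (sym q)))
  joins-unique {e} {e′} (inj₁ p) (inj₂ q) = simple e e′ (inj₂ (trans p (cong Product.swap (sym q))))
  joins-unique {e} {e′} (inj₂ p) (inj₁ q) = simple e e′ (inj₂ (trans p (cong Product.swap (sym q))))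

  joins⇒endpoint : ∀ {e a b u} → Joins G e a b → IncidentTo G u e → a ≡ u ⊎ b ≡ u
  joins⇒endpoint (inj₁ p) (inj₁ q) = inj₁ (trans (sym (cong proj₁ p)) q)
  joins⇒endpoint (inj₁ p) (inj₂ q) = inj₂ (trans (sym (cong proj₂ p)) q)
  joins⇒endpoint (inj₂ p) (inj₁ q) = inj₂ (trans (sym (cong proj₁ p)) q)
  joins⇒endpoint (inj₂ p) (inj₂ q) = inj₁ (trans (sym (cong proj₂ p)) q)

  joins⇒incidentˡ : ∀ {e a b} → Joins G e a b → IncidentTo G a e
  joins⇒incidentˡ (inj₁ p) = inj₁ (cong proj₁ p)
  joins⇒incidentˡ (inj₂ p) = inj₂ (cong proj₂ p)

  joins⇒incidentʳ : ∀ {e a b} → Joins G e a b → IncidentTo G b e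
  joins⇒incidentʳ (inj₁ p) = inj₂ (cong proj₂ p)
  joins⇒incidentʳ (inj₂ p) = inj₁ (cong proj₁ p)

  incident⇔ : ∀ {e u} → e ∈ incident G u ⇔ IncidentTo G u e
  incident⇔ {e} {u} = mk⇔
    (λ e∈ → Sum.map (toWitness {a? = end₁?}) (toWitness {a? = end₂?})
                    (to T-∨ (from T-≡ (trans (sym (lookup∘tabulate at-u e)) (∈⇒lookup e∈)))))
    (λ inc → lookup⇒∈ (trans (lookup∘tabulate at-u e)
                    (to T-≡ (from (T-∨ {⌊ end₁? ⌋}) (Sum.map fromWitness fromWitness inc)))))
    where
    open Equivalence
    at-u : Fin E → Bool
    at-u e = ⌊ proj₁ (ends e) ≟ u ⌋ ∨ ⌊ proj₂ (ends e) ≟ u ⌋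
    end₁? = proj₁ (ends e) ≟ u
    end₂? = proj₂ (ends e) ≟ u

  oddAt : Fin V → Subset E → Bool
  oddAt u Y = parity (Y ∩ incident G u)

  oddAt-⊕ : ∀ u A B → oddAt u (A ⊕ B) ≡ oddAt u A xor oddAt u B
  oddAt-⊕ u A B = trans (cong parity (∩-distribʳ-⊕ A B (incident G u)))
                        (parity-⊕ (A ∩ incident G u) (B ∩ incident G u))

  oddAt⇒edge : ∀ u Y → oddAt u Y ≡ true → ∃ λ e → e ∈ Y × IncidentTo G u e
  oddAt⇒edge u Y odd =
    let e , e∈Y∩inc = parity-true⇒nonempty odd
        e∈Y , e∈inc = x∈p∩q⁻ Y (incident G u) e∈Y∩inc
    in e , e∈Y , Equivalence.to incident⇔ e∈inc

  oddDegree⇒oddAt : ∀ u S → OddDegIn G S u → oddAt u S ≡ true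
  oddDegree⇒oddAt u S odd =
    trans (sym (isOdd-∣∣ (S ∩ incident G u))) (%2≡1⇒isOdd ∣ S ∩ incident G u ∣ odd)

  lookup-at-incident : ∀ {u e} Y → IncidentTo G u e → lookup (Y ∩ incident G u) e ≡ lookup Y e
  lookup-at-incident {u} {e} Y inc = begin
    lookup (Y ∩ incident G u) e              ≡⟨ lookup-zipWith _ e Y (incident G u) ⟩
    lookup Y e ∧ lookup (incident G u) e
      ≡⟨ cong (lookup Y e ∧_) (∈⇒lookup (Equivalence.from incident⇔ inc)) ⟩
    lookup Y e ∧ true                        ≡⟨ ∧-identityʳ _ ⟩
    lookup Y e                               ∎
    where open ≡-Reasoning

module CircuitFacts (G : Graph) {X : Subset (Graph.E G)} {k : ℕ}
                    {w : Fin (suc (suc (suc k))) → Fin (Graph.V G)} (w-inj : Injective _≡_ _≡_ w)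
                    (edge-at : ∀ i → ∃ λ e → Joins G e (w i) (w (next G i)))
                    (X⇔ : ∀ e → (e ∈ X ⇔ (∃ λ i → Joins G e (w i) (w (next G i))))) where
  open Graph G
  open GraphFacts G
  open CyclicSuccessor G
  open Equivalence

  edge : Fin (suc (suc (suc k))) → Fin E
  edge i = proj₁ (edge-at i)

  edge-joins : ∀ i → Joins G (edge i) (w i) (w (next G i))
  edge-joins i = proj₂ (edge-at i)

  edge∈X : ∀ i → edge i ∈ X
  edge∈X i = from (X⇔ (edge i)) (i , edge-joins i)

  X-edge : ∀ {e} → e ∈ X → ∃ λ i → e ≡ edge i
  X-edge {e} e∈X = let i , joins = to (X⇔ e) e∈X in i , joins-unique joins (edge-joins i)

  -- Consecutive edges differ: they would join the same pair, forcing a cycle of length ≤ 2.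
  consecutive-edges-differ : ∀ j → edge j ≢ edge (next G j)
  consecutive-edges-differ j same
    with edge-joins j | subst (λ e → Joins G e (w (next G j)) (w (next G (next G j)))) (sym same)
                                (edge-joins (next G j))
  ... | inj₁ p | inj₁ q = next≢ j (sym (w-inj (cong proj₁ (trans (sym p) q))))
  ... | inj₁ p | inj₂ q = next²≢ j (sym (w-inj (cong proj₁ (trans (sym p) q))))
  ... | inj₂ p | inj₁ q = next²≢ j (sym (w-inj (cong proj₂ (trans (sym p) q))))
  ... | inj₂ p | inj₂ q = next≢ (next G j) (sym (w-inj (cong proj₁ (trans (sym p) q))))

  edges-at-vertex : ∀ p {e} → e ∈ X → IncidentTo G (w (next G p)) e → e ≡ edge p ⊎ e ≡ edge (next G p)
  edges-at-vertex p e∈X inc with X-edge e∈X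
  ... | i , refl with joins⇒endpoint (edge-joins i) inc
  ...   | inj₁ wi≡ = inj₂ (cong edge (w-inj wi≡))
  ...   | inj₂ wni≡ = inj₁ (cong edge (next-injective (w-inj wni≡)))

  oddAt-on-cycle : ∀ {Z} → Z ⊆ X → ∀ p →
                   oddAt (w (next G p)) Z ≡ lookup Z (edge p) xor lookup Z (edge (next G p))
  oddAt-on-cycle {Z} Z⊆X p = begin
    parity (Z ∩ incident G u)
      ≡⟨ parity-pair (consecutive-edges-differ p) only-cycle-edges ⟩
    lookup (Z ∩ incident G u) (edge p) xor lookup (Z ∩ incident G u) (edge (next G p))
      ≡⟨ cong₂ _xor_ (lookup-at-incident Z (joins⇒incidentʳ (edge-joins p)))
                     (lookup-at-incident Z (joins⇒incidentˡ (edge-joins (next G p)))) ⟩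
    lookup Z (edge p) xor lookup Z (edge (next G p)) ∎
    where
    open ≡-Reasoning
    u = w (next G p)
    only-cycle-edges : ∀ {e} → e ∈ Z ∩ incident G u → e ≡ edge p ⊎ e ≡ edge (next G p)
    only-cycle-edges e∈ = let e∈Z , e∈inc = x∈p∩q⁻ Z (incident G u) e∈
                          in edges-at-vertex p (Z⊆X e∈Z) (to incident⇔ e∈inc)

  circuit-even : ∀ u → oddAt u X ≡ false
  circuit-even u with any? (λ j → w j ≟ u)
  ... | yes (j , refl) =
    let p , next-p≡j = next-surjective j
    in trans (cong (λ i → oddAt (w i) X) (sym next-p≡j))
             (trans (oddAt-on-cycle (λ e∈X → e∈X) p)
                    (cong₂ _xor_ (∈⇒lookup (edge∈X p)) (∈⇒lookup (edge∈X (next G p)))))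
  ... | no off-cycle = parity-empty λ (e , e∈) →
    let e∈X , e∈inc = x∈p∩q⁻ X (incident G u) e∈
        i , e≡edge-i = X-edge e∈X
        inc = to incident⇔ (subst (_∈ incident G u) e≡edge-i e∈inc)
    in case joins⇒endpoint (edge-joins i) inc of λ where
         (inj₁ wi≡u)  → off-cycle (i , wi≡u)
         (inj₂ wni≡u) → off-cycle (next G i , wni≡u)

  circuit-minimal : ∀ {Z} → Z ⊆ X → (∀ u → oddAt u Z ≡ false) → Nonempty Z → X ⊆ Z
  circuit-minimal {Z} Z⊆X even (x , x∈Z) {y} y∈X with X-edge (Z⊆X x∈Z) | X-edge y∈X
  ... | i , refl | j , refl = lookup⇒∈ (trans (constant j) (trans (sym (constant i)) (∈⇒lookup x∈Z)))
    where
    -- Z contains either every cycle edge or none: membership propagates along the cycle.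
    constant : ∀ j → lookup Z (edge j) ≡ lookup Z (edge zero)
    constant = next-induction (λ j → lookup Z (edge j) ≡ lookup Z (edge zero)) refl
      λ i same → trans (sym (xor≡false⇒≡ _ _ (trans (sym (oddAt-on-cycle Z⊆X i)) (even _)))) same

  circuit-nonempty : Nonempty X
  circuit-nonempty = edge zero , edge∈X zero

any-function? : ∀ {m} n (P : (Fin n → Fin m) → Set) → (∀ {f g} → (∀ i → f i ≡ g i) → P f → P g) →
                (∀ f → Dec (P f)) → Dec (∃ P)
any-function? zero P resp P? =
  map′ (λ p → none , p) (λ (f , pf) → resp (λ ()) pf) (P? none)
  where
  none : Fin zero → Fin _
  none ()
any-function? (suc n) P resp P? =
  map′ (λ (x , g , p) → x Vector.∷ g , p)
       (λ (f , pf) → head f , tail f , resp (λ { zero → refl ; (suc i) → refl }) pf)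
       (any? λ x → any-function? n (P ∘ (x Vector.∷_))
                     (λ f≗g → resp λ { zero → refl ; (suc i) → f≗g i }) (P? ∘ (x Vector.∷_)))

-- Whether G has a circuit through given vertices v₀, …, vₙ is decidable: a
-- circuit is determined by its cyclic vertex sequence, which has length at
-- most V, so it suffices to search all sequences of each length k + 3 ≤ V.
module CircuitsThrough (G : Graph) {n} (v : Fin (suc n) → Fin (Graph.V G)) where
  open Graph G
  open Equivalence

  CircuitThroughAll : Set
  CircuitThroughAll = ∃ λ C → IsCircuit G C × (∀ i → VertexOf G (v i) C)

  OnCycle : ∀ {k} → (Fin (suc (suc (suc k))) → Fin V) → Fin E → Set
  OnCycle w e = ∃ λ j → Joins G e (w j) (w (next G j))

  CycleThroughAll : ∀ k → (Fin (suc (suc (suc k))) → Fin V) → Set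
  CycleThroughAll k w =
    Injective _≡_ _≡_ w × (∀ i → ∃ λ e → Joins G e (w i) (w (next G i))) ×
    (∀ i → ∃ λ e → OnCycle w e × IncidentTo G (v i) e)

  joins? : ∀ e a b → Dec (Joins G e a b)
  joins? e a b = ≡-dec _≟_ _≟_ (ends e) (a , b) ⊎-dec ≡-dec _≟_ _≟_ (ends e) (b , a)

  incidentTo? : ∀ u e → Dec (IncidentTo G u e)
  incidentTo? u e = (proj₁ (ends e) ≟ u) ⊎-dec (proj₂ (ends e) ≟ u)

  onCycle? : ∀ {k} (w : Fin (suc (suc (suc k))) → Fin V) e → Dec (OnCycle w e)
  onCycle? w e = any? λ j → joins? e (w j) (w (next G j))

  cycleThroughAll? : ∀ k w → Dec (CycleThroughAll k w)
  cycleThroughAll? k w =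
    map′ (λ inj {i} {j} → inj i j) (λ inj i j → inj) (all? λ i → all? λ j → (w i ≟ w j) →-dec (i ≟ j))
    ×-dec all? (λ i → any? λ e → joins? e (w i) (w (next G i)))
    ×-dec all? (λ i → any? λ e → onCycle? w e ×-dec incidentTo? (v i) e)

  cycleThroughAll-resp : ∀ {k w w′} → (∀ i → w i ≡ w′ i) → CycleThroughAll k w → CycleThroughAll k w′
  cycleThroughAll-resp {k} {w} {w′} w≗w′ (inj , edges , through) =
    (λ {i} {j} eq → inj (trans (w≗w′ i) (trans eq (sym (w≗w′ j))))) ,
    (λ i → let e , joins = edges i in e , transport i joins) ,
    (λ i → let e , (j , joins) , inc = through i in e , (j , transport j joins) , inc)
    where
    transport : ∀ j {e} → Joins G e (w j) (w (next G j)) → Joins G e (w′ j) (w′ (next G j))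
    transport j = subst₂ (Joins G _) (w≗w′ j) (w≗w′ (next G j))

  cycle⇒circuit : (∃ λ k → k < V × ∃ (CycleThroughAll k)) → CircuitThroughAll
  cycle⇒circuit (k , _ , w , inj , edges , through) =
    subsetOf (onCycle? w) , (k , w , inj , edges , λ e → ∈subsetOf⇔ (onCycle? w)) ,
    λ i → let e , onC , inc = through i in e , from (∈subsetOf⇔ (onCycle? w)) onC , inc

  circuit⇒cycle : CircuitThroughAll → ∃ λ k → k < V × ∃ (CycleThroughAll k)
  circuit⇒cycle (C , (k , w , inj , edges , C⇔) , through) =
    k , ℕ.≤-trans (ℕ.m≤n+m (suc k) 2) (injective⇒≤ inj) , w , inj , edges ,
    λ i → let e , e∈C , inc = through i in e , to (C⇔ e) e∈C , inc

  circuitThroughAll? : Dec CircuitThroughAll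
  circuitThroughAll? = map′ cycle⇒circuit circuit⇒cycle
    (ℕ.anyUpTo? (λ k → any-function? _ (CycleThroughAll k) cycleThroughAll-resp (cycleThroughAll? k)) V)

module WithoutCircuitThroughAll (G : Graph) (S : Subset (Graph.E G)) {n}
         (v : Fin (suc n) → Fin (Graph.V G)) (odd : ∀ i → OddDegIn G S (v i)) where
  open Graph G
  open GraphFacts G
  open CircuitsThrough G v
  open Equivalence

  Even : Subset E → Set
  Even Y = ∀ u → oddAt u Y ≡ false

  LikeS : Subset E → Set
  LikeS Y = ∀ u → oddAt u Y ≡ oddAt u S

  W : Subset E → Set
  W Y = Even Y ⊎ LikeS Y

  W? : ∀ Y → Dec (W Y)
  W? Y = all? (λ u → oddAt u Y ≟ᵇ false) ⊎-dec all? (λ u → oddAt u Y ≟ᵇ oddAt u S)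

  -- W is closed under ⊕ since parities add: even + even and like-S + like-S are even.
  W-⊕ : ∀ A B → W A → W B → W (A ⊕ B)
  W-⊕ A B (inj₁ a) (inj₁ b) = inj₁ λ u → trans (oddAt-⊕ u A B) (cong₂ _xor_ (a u) (b u))
  W-⊕ A B (inj₁ a) (inj₂ b) = inj₂ λ u → trans (oddAt-⊕ u A B) (cong₂ _xor_ (a u) (b u))
  W-⊕ A B (inj₂ a) (inj₁ b) =
    inj₂ λ u → trans (oddAt-⊕ u A B) (trans (cong₂ _xor_ (a u) (b u)) (xor-identityʳ _))
  W-⊕ A B (inj₂ a) (inj₂ b) =
    inj₁ λ u → trans (oddAt-⊕ u A B) (trans (cong₂ _xor_ (a u) (b u)) (xor-same (oddAt u S)))

  open BinaryMatroidOf W W? W-⊕ public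

  S-odd-at-v : ∀ i → oddAt (v i) S ≡ true
  S-odd-at-v i = oddDegree⇒oddAt (v i) S (odd i)

  circuit⇒minimal-member : ¬ CircuitThroughAll → ∀ X → IsCircuit G X → IsMinimalMember X
  circuit⇒minimal-member none X isC@(k , w , w-inj , edges , X⇔) =
    inj₁ circuit-even , circuit-nonempty , minimal
    where
    open CircuitFacts G w-inj edges X⇔
    minimal : ∀ Z → W Z → Z ⊆ X → Nonempty Z → X ⊆ Z
    minimal Z (inj₁ even) Z⊆X neZ = circuit-minimal Z⊆X even neZ
    minimal Z (inj₂ likeS) Z⊆X _ = contradiction (X , isC , through) none
      where
      through : ∀ i → VertexOf G (v i) X
      through i =
        let e , e∈Z , inc = oddAt⇒edge (v i) Z (trans (likeS (v i)) (S-odd-at-v i))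
        in e , Z⊆X e∈Z , inc

  identity-circuit-injection : ¬ CircuitThroughAll → IsCircuitInjection G matroid id
  identity-circuit-injection none =
    bijective _≡_ , λ X isC → X , circuit⇒minimal-member none X isC , λ _ → mk⇔ id id

  OddSomewhere : Subset E → Set
  OddSomewhere Y = ∃ λ u → oddAt u Y ≡ true

  odd-split : ∀ Z Z′ → OddSomewhere Z → OddSomewhere Z′ ⊎ OddSomewhere (Z ⊕ Z′)
  odd-split Z Z′ (u , oddZ) with oddAt u Z′ in oddZ′
  ... | true  = inj₁ (u , oddZ′)
  ... | false = inj₂ (u , trans (oddAt-⊕ u Z Z′) (cong₂ _xor_ oddZ oddZ′))

  open Descent OddSomewhere odd-split using (minimal-below)

  -- The identity is nontrivial: a minimal member of W inside S that is odd
  -- somewhere is not the edge set of a circuit of G, as circuits are even.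
  nontrivial : ∃ λ Y → IsMinimalMember Y × ¬ (∃ λ X → IsCircuit G X × MapsTo G matroid id X Y)
  nontrivial =
    let D , minD , _ , (u , oddD) = minimal-below (inj₂ (λ _ → refl)) S-nonempty (v zero , S-odd-at-v zero)
    in D , minD , λ (X , (k , w , w-inj , edges , X⇔) , maps) →
       let open CircuitFacts G w-inj edges X⇔
           X≡D = ⊆-antisym (to (maps _)) (from (maps _))
       in case trans (sym oddD) (trans (cong (oddAt u) (sym X≡D)) (circuit-even u)) of λ ()
    where
    S-nonempty : Nonempty S
    S-nonempty = let e , e∈S , _ = oddAt⇒edge (v zero) S (S-odd-at-v zero) in e , e∈S

-- The theorem: if there is no circuit through all vᵢ, the identity on edges is
-- a nontrivial circuit injection of G_M into the binary matroid B above.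
lemma2p1 : (G : Graph) → NoIsolatedVertices G → NoNontrivialBinaryCircuitInjection G →
    ∀ (S : Subset (Graph.E G)) (n : ℕ) (v : Fin (suc n) → Fin (Graph.V G)) →
    (∀ i → OddDegIn G S (v i)) →
    ∃ λ C → IsCircuit G C × (∀ i → VertexOf G (v i) C)
lemma2p1 G _ no-injection S n v odd with CircuitsThrough.circuitThroughAll? G v
... | yes found = found
... | no none = contradiction
  (matroid , binary , id , identity-circuit-injection none , nontrivial) no-injection
  where open WithoutCircuitThroughAll G S v odd
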